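{- SRPT is $O(\sqrt n)$-competitive for minimizing the $\ell_2$ norm of flow time: for every instance with $n$ jobs, $\sqrt{F(\mathcal{SRPT})}\le\sqrt{n}\,\sqrt{F(\mathcal{OPT})}$.
   Context: A single machine and $n$ jobs; job $J_i$ has integer release time $r_i\ge0$ and integer processing time $p_i\ge1$. Time is divided into unit slots $[t]=[t,t+1)$; a (preemptive) schedule assigns each slot to at most one job so that $J_i$ receives exactly $p_i$ slots, all with $t\ge r_i$. $c_i(\mathcal{S})$ is the completion time of $J_i$, $f_i(\mathcal{S})=c_i(\mathcal{S})-r_i$, $F(\mathcal{S})=\sum_i f_i(\mathcal{S})^2$, the $\ell_2$ norm of flow time is $\sqrt{F(\mathcal{S})}$, and $\mathcal{OPT}$ minimizes $F$. $\mathcal{SRPT}$ is the schedule of the Shortest Remaining Processing Time algorithm, which in each slot executes a released, unfinished job with the least remaining processing time. -}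

module Defs where

open import Data.Nat using (ℕ; zero; suc; _+_; _*_; _∸_; _≤_; _<_)
open import Data.Fin using (Fin)
open import Data.Fin.Properties using () renaming (_≟_ to _≟ᶠ_)
open import Data.Maybe using (Maybe; just; nothing)
open import Data.List using (List; map; allFin)
open import Data.Nat.ListAction using (sum)
open import Data.Product using (Σ; _×_; ∃)
open import Relation.Binary.PropositionalEquality using (_≡_)
open import Relation.Nullary using (yes; no)

-- A (preemptive, unit-slot) schedule for n jobs (jobs are Fin n):
-- slot t = just i means slot [t,t+1) is given to job i, nothing = idle.
-- 'horizon' is a time after which every slot is idle (finiteness).
record Schedule (n : ℕ) : Set where
  field
    horizon : ℕ
    slot    : ℕ → Maybe (Fin n)
open Schedule public

hit : ∀ {n} → Maybe (Fin n) → Fin n → ℕ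
hit nothing  i = 0
hit (just j) i with j ≟ᶠ i
... | yes _ = 1
... | no  _ = 0

served : ∀ {n} → (ℕ → Maybe (Fin n)) → Fin n → ℕ → ℕ
served σ i zero    = 0
served σ i (suc t) = served σ i t + hit (σ t) i

-- (index of last slot < t assigned to i) + 1, or 0 if none
lastEnd : ∀ {n} → (ℕ → Maybe (Fin n)) → Fin n → ℕ → ℕ
lastEnd σ i zero = 0
lastEnd σ i (suc t) with hit (σ t) i
... | 0 = lastEnd σ i t
... | _ = suc t

completion : ∀ {n} → Schedule n → Fin n → ℕ
completion S i = lastEnd (slot S) i (horizon S)

flow : ∀ {n} → (Fin n → ℕ) → Schedule n → Fin n → ℕ
flow r S i = completion S i ∸ r i

F : ∀ {n} → (Fin n → ℕ) → Schedule n → ℕ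
F {n} r S = sum (map (λ i → flow r S i * flow r S i) (allFin n))

Feasible : ∀ {n} → (r p : Fin n → ℕ) → Schedule n → Set
Feasible r p S =
  (∀ t → horizon S ≤ t → slot S t ≡ nothing)
  × (∀ i → served (slot S) i (horizon S) ≡ p i)
  × (∀ t i → slot S t ≡ just i → r i ≤ t)

remaining : ∀ {n} → (p : Fin n → ℕ) → Schedule n → Fin n → ℕ → ℕ
remaining p S i t = p i ∸ served (slot S) i t

Active : ∀ {n} → (r p : Fin n → ℕ) → Schedule n → ℕ → Fin n → Set
Active r p S t i = r i ≤ t × served (slot S) i t < p i

IsSRPT : ∀ {n} → (r p : Fin n → ℕ) → Schedule n → Set
IsSRPT r p S =
  ∀ t → ∃ (Active r p S t) →
    Σ _ λ i → slot S t ≡ just i × Active r p S t i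
              × (∀ j → Active r p S t j → remaining p S i t ≤ remaining p S j t)

-- SRPT is optimal for total flow time, so F(SRPT) ≤ (Σ f_SRPT)² ≤ (Σ f_OPT)² ≤ n · F(OPT) by
-- Cauchy–Schwarz. Total flow time is the integral over time of the number of pending jobs, and
-- SRPT has the fewest pending jobs at every moment. This follows from the invariant that, for
-- every threshold x, the shortfall Σᵢ (x ∸ remainingᵢ(t)) of SRPT dominates that of any other
-- schedule: at x = 1 the shortfall counts the finished jobs. The invariant is kept slot by slot;
-- in the only delicate case the other schedule works on a job with remaining time at most x
-- while SRPT does not, and then the invariant at x + 1 provides the missing unit.
module Submission where

open import Data.Fin using (Fin; zero; suc; punchIn)
open import Data.Fin.Properties using (punchInᵢ≢i; any?) renaming (_≟_ to _≟ᶠ_)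
open import Data.List using (map; allFin; tabulate)
open import Data.List.Properties using (map-tabulate)
open import Data.Maybe using (Maybe; just; nothing)
open import Data.Nat
open import Data.Nat.Properties
open import Data.Nat.Tactic.RingSolver using (solve-∀)
import Data.Nat.ListAction as ListAction
open import Data.Product using (_×_; _,_; proj₁; proj₂; ∃)
open import Data.Sum using (_⊎_; inj₁; inj₂; [_,_]′)
open import Data.Vec.Functional using (removeAt)
open import Function using (_∘_; id)
open import Function.Bundles using (_⇔_; Equivalence; mk⇔)
open import Relation.Binary.PropositionalEquality
open import Relation.Nullary using (Dec; yes; no; ¬_; contradiction)
open import Relation.Nullary.Decidable using (_×-dec_)
open import Algebra.Properties.Semiring.Sum +-*-semiring
  using (sum; sum-syntax; sum-remove; sum-cong-≗; sum-replicate-zero; ∑-distrib-+; *-distribˡ-sum)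

open import Defs

sum-tabulate : ∀ n (f : Fin n → ℕ) → ListAction.sum (tabulate f) ≡ ∑[ i < n ] f i
sum-tabulate zero    f = refl
sum-tabulate (suc n) f = cong (f zero +_) (sum-tabulate n (f ∘ suc))

sum-allFin : ∀ n (f : Fin n → ℕ) → ListAction.sum (map f (allFin n)) ≡ ∑[ i < n ] f i
sum-allFin n f = trans (cong ListAction.sum (map-tabulate id f)) (sum-tabulate n f)

∑-mono-≤ : ∀ {n} {f g : Fin n → ℕ} → (∀ i → f i ≤ g i) → ∑[ i < n ] f i ≤ ∑[ i < n ] g i
∑-mono-≤ {zero}  f≤g = z≤n
∑-mono-≤ {suc n} f≤g = +-mono-≤ (f≤g zero) (∑-mono-≤ (f≤g ∘ suc))

∑-mono-< : ∀ {n} {f g : Fin n → ℕ} → (∀ i → f i ≤ g i) → ∀ j → f j < g j →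
           ∑[ i < n ] f i < ∑[ i < n ] g i
∑-mono-< f≤g zero    fj<gj = +-mono-<-≤ fj<gj (∑-mono-≤ (f≤g ∘ suc))
∑-mono-< f≤g (suc j) fj<gj = +-mono-≤-< (f≤g zero) (∑-mono-< (f≤g ∘ suc) j fj<gj)

2mn≤m²+n² : ∀ m n → 2 * (m * n) ≤ m * m + n * n
2mn≤m²+n² m n = [ below , swapped ]′ (≤-total m n)
  where
  square-gap : ∀ m d → 2 * (m * (m + d)) + d * d ≡ m * m + (m + d) * (m + d)
  square-gap = solve-∀
  below : ∀ {m n} → m ≤ n → 2 * (m * n) ≤ m * m + n * n
  below {m} m≤n = subst (λ n → 2 * (m * n) ≤ m * m + n * n) (m+[n∸m]≡n m≤n)
                    (m+n≤o⇒m≤o _ (≤-reflexive (square-gap m (_ ∸ m))))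
  swapped : n ≤ m → 2 * (m * n) ≤ m * m + n * n
  swapped n≤m = subst₂ _≤_ (cong (2 *_) (*-comm n m)) (+-comm (n * n) (m * m)) (below n≤m)

cauchy-schwarz-step : ∀ k x s q → s * s ≤ k * q → (x + s) * (x + s) ≤ suc k * (x * x + q)
cauchy-schwarz-step zero x zero q _ = m+n≤o⇒m≤o _ (≤-reflexive (expand x q))
  where
  expand : ∀ x q → (x + 0) * (x + 0) + q ≡ 1 * (x * x + q)
  expand = solve-∀
cauchy-schwarz-step (suc k) x s q s²≤kq = begin
  (x + s) * (x + s)                 ≡⟨ expand x s ⟩
  x * x + 2 * (x * s) + s * s       ≤⟨ +-mono-≤ (+-monoʳ-≤ (x * x) cross) s²≤kq ⟩
  x * x + (K * (x * x) + q) + K * q ≡⟨ collect K x q ⟩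
  suc K * (x * x + q)               ∎
  where
  open ≤-Reasoning
  K = suc k
  expand : ∀ x s → (x + s) * (x + s) ≡ x * x + 2 * (x * s) + s * s
  expand = solve-∀
  collect : ∀ K x q → x * x + (K * (x * x) + q) + K * q ≡ suc K * (x * x + q)
  collect = solve-∀
  scale : ∀ K x s → K * (2 * (x * s)) ≡ 2 * ((K * x) * s)
  scale = solve-∀
  square : ∀ K x q → (K * x) * (K * x) + K * q ≡ K * (K * (x * x) + q)
  square = solve-∀
  cross : 2 * (x * s) ≤ K * (x * x) + q
  cross = *-cancelˡ-≤ K (begin
    K * (2 * (x * s))                 ≡⟨ scale K x s ⟩
    2 * ((K * x) * s)                 ≤⟨ 2mn≤m²+n² (K * x) s ⟩
    (K * x) * (K * x) + s * s         ≤⟨ +-monoʳ-≤ _ s²≤kq ⟩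
    (K * x) * (K * x) + K * q         ≡⟨ square K x q ⟩
    K * (K * (x * x) + q)             ∎)

∑-cauchy-schwarz : ∀ n (f : Fin n → ℕ) →
  (∑[ i < n ] f i) * (∑[ i < n ] f i) ≤ n * ∑[ i < n ] (f i * f i)
∑-cauchy-schwarz zero    f = z≤n
∑-cauchy-schwarz (suc n) f = cauchy-schwarz-step n (f zero) _ _ (∑-cauchy-schwarz n (f ∘ suc))

∑-squares≤square-∑ : ∀ n (f : Fin n → ℕ) →
  ∑[ i < n ] (f i * f i) ≤ (∑[ i < n ] f i) * (∑[ i < n ] f i)
∑-squares≤square-∑ zero    f = z≤n
∑-squares≤square-∑ (suc n) f = begin
  x * x + ∑[ i < n ] (f (suc i) * f (suc i)) ≤⟨ +-monoʳ-≤ (x * x) (∑-squares≤square-∑ n (f ∘ suc)) ⟩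
  x * x + s * s                              ≤⟨ m≤m+n _ (2 * (x * s)) ⟩
  x * x + s * s + 2 * (x * s)                ≡⟨ expand x s ⟩
  (x + s) * (x + s)                          ∎
  where
  open ≤-Reasoning
  x = f zero
  s = ∑[ i < n ] f (suc i)
  expand : ∀ x s → x * x + s * s + 2 * (x * s) ≡ (x + s) * (x + s)
  expand = solve-∀

m∸n≤1+m∸[1+n] : ∀ m n → m ∸ n ≤ suc (m ∸ suc n)
m∸n≤1+m∸[1+n] zero    n       = subst (_≤ 1) (sym (0∸n≡0 n)) z≤n
m∸n≤1+m∸[1+n] (suc m) zero    = ≤-refl
m∸n≤1+m∸[1+n] (suc m) (suc n) = m∸n≤1+m∸[1+n] m n

m∸[n∸1]≤1+m∸n : ∀ m n → m ∸ (n ∸ 1) ≤ suc (m ∸ n)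
m∸[n∸1]≤1+m∸n m zero    = n≤1+n m
m∸[n∸1]≤1+m∸n m (suc n) = m∸n≤1+m∸[1+n] m n

m<n⇒m∸[n∸1]≡m∸n : ∀ {m n} → m < n → m ∸ (n ∸ 1) ≡ m ∸ n
m<n⇒m∸[n∸1]≡m∸n (s≤s m≤n) = trans (m≤n⇒m∸n≡0 m≤n) (sym (m≤n⇒m∸n≡0 (m≤n⇒m≤1+n m≤n)))

0<n≤m⇒m∸[n∸1]≡1+m∸n : ∀ {m n} → 0 < n → n ≤ m → m ∸ (n ∸ 1) ≡ suc (m ∸ n)
0<n≤m⇒m∸[n∸1]≡1+m∸n {suc m} {suc n} _ (s≤s n≤m) = +-∸-assoc 1 n≤m

sumBelow : ℕ → (ℕ → ℕ) → ℕ
sumBelow zero    g = 0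
sumBelow (suc M) g = sumBelow M g + g M

sumBelow-mono-≤ : ∀ M {g h : ℕ → ℕ} → (∀ t → g t ≤ h t) → sumBelow M g ≤ sumBelow M h
sumBelow-mono-≤ zero    g≤h = z≤n
sumBelow-mono-≤ (suc M) g≤h = +-mono-≤ (sumBelow-mono-≤ M g≤h) (g≤h M)

sumBelow-cong : ∀ M {g h : ℕ → ℕ} → (∀ t → g t ≡ h t) → sumBelow M g ≡ sumBelow M h
sumBelow-cong zero    g≡h = refl
sumBelow-cong (suc M) g≡h = cong₂ _+_ (sumBelow-cong M g≡h) (g≡h M)

∑-sumBelow-comm : ∀ {n} M (g : Fin n → ℕ → ℕ) →
  ∑[ i < n ] sumBelow M (g i) ≡ sumBelow M (λ t → ∑[ i < n ] g i t)
∑-sumBelow-comm {n} zero    g = sum-replicate-zero n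
∑-sumBelow-comm {n} (suc M) g = trans (∑-distrib-+ (λ i → sumBelow M (g i)) (λ i → g i M))
                                      (cong (_+ ∑[ i < n ] g i M) (∑-sumBelow-comm M g))

𝟙 : ∀ {a} {A : Set a} → Dec A → ℕ
𝟙 (yes _) = 1
𝟙 (no _)  = 0

𝟙-cong : ∀ {a b} {A : Set a} {B : Set b} → A ⇔ B → (a? : Dec A) (b? : Dec B) → 𝟙 a? ≡ 𝟙 b?
𝟙-cong A⇔B (yes a) (yes b) = refl
𝟙-cong A⇔B (yes a) (no ¬b) = contradiction (Equivalence.to A⇔B a) ¬b
𝟙-cong A⇔B (no ¬a) (yes b) = contradiction (Equivalence.from A⇔B b) ¬a
𝟙-cong A⇔B (no ¬a) (no ¬b) = refl

sumBelow-interval : ∀ r c M → sumBelow M (λ t → 𝟙 (r ≤? t ×-dec t <? c)) ≡ (M ⊓ c) ∸ r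
sumBelow-interval r c zero = sym (0∸n≡0 r)
sumBelow-interval r c (suc M) rewrite sumBelow-interval r c M with r ≤? M | M <? c
... | yes r≤M | yes M<c rewrite m≤n⇒m⊓n≡m (<⇒≤ M<c) | m≤n⇒m⊓n≡m M<c =
  trans (+-comm (M ∸ r) 1) (sym (+-∸-assoc 1 r≤M))
... | no r≰M | yes M<c rewrite m≤n⇒m⊓n≡m (<⇒≤ M<c) | m≤n⇒m⊓n≡m M<c
                             | m≤n⇒m∸n≡0 (<⇒≤ (≰⇒> r≰M)) | m≤n⇒m∸n≡0 (≰⇒> r≰M) = refl
... | yes _ | no M≮c rewrite m≥n⇒m⊓n≡n (≮⇒≥ M≮c) | m≥n⇒m⊓n≡n (m≤n⇒m≤1+n (≮⇒≥ M≮c)) = +-identityʳ _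
... | no _  | no M≮c rewrite m≥n⇒m⊓n≡n (≮⇒≥ M≮c) | m≥n⇒m⊓n≡n (m≤n⇒m≤1+n (≮⇒≥ M≮c)) = +-identityʳ _

-- The remaining times of released jobs while SRPT runs no job with remaining time in [1, x].
Extreme : ℕ → ℕ → Set
Extreme x a = a ≡ 0 ⊎ x < a

extreme-balanced : ∀ {x a} → Extreme x a → suc x * (x ∸ a) ≡ x * (suc x ∸ a)
extreme-balanced {x} (inj₁ refl) = *-comm (suc x) x
extreme-balanced {x} (inj₂ x<a)
  rewrite m≤n⇒m∸n≡0 (<⇒≤ x<a) | m≤n⇒m∸n≡0 x<a = trans (*-zeroʳ (suc x)) (sym (*-zeroʳ x))

weighted-∸-gap : ∀ {x b} → b ≤ x → suc x * (x ∸ b) + b ≡ x * (suc x ∸ b)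
weighted-∸-gap {b = b} b≤x with (k , refl) ← m≤n⇒∃[o]m+o≡n b≤x
  rewrite m+n∸m≡n b k | sym (+-suc b k) | m+n∸m≡n b (suc k) = expand b k
  where
  expand : ∀ b k → k + (b + k) * k + b ≡ (b + k) * suc k
  expand = solve-∀

weighted-∸-≤ : ∀ x b → suc x * (x ∸ b) ≤ x * (suc x ∸ b)
weighted-∸-≤ x b with b ≤? x
... | yes b≤x = m+n≤o⇒m≤o _ (≤-reflexive (weighted-∸-gap b≤x))
... | no  b≰x rewrite m≤n⇒m∸n≡0 (<⇒≤ (≰⇒> b≰x)) | m≤n⇒m∸n≡0 (≰⇒> b≰x) | *-zeroʳ x = ≤-refl

weighted-∸-< : ∀ {x b} → 0 < b → b ≤ x → suc x * (x ∸ b) < x * (suc x ∸ b)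
weighted-∸-< {x} {b} 0<b b≤x = begin-strict
  suc x * (x ∸ b)     <⟨ m<m+n _ 0<b ⟩
  suc x * (x ∸ b) + b ≡⟨ weighted-∸-gap b≤x ⟩
  x * (suc x ∸ b)     ∎
  where open ≤-Reasoning

exchange-≤ : ∀ x a b → a ≡ b ⊎ Extreme x a →
  suc x * (x ∸ b) + x * (suc x ∸ a) ≤ suc x * (x ∸ a) + x * (suc x ∸ b)
exchange-≤ x a .a (inj₁ refl) = ≤-refl
exchange-≤ x a b  (inj₂ ext)  = begin
  suc x * (x ∸ b) + x * (suc x ∸ a)     ≡⟨ cong (suc x * (x ∸ b) +_) (sym (extreme-balanced ext)) ⟩
  suc x * (x ∸ b) + suc x * (x ∸ a)     ≤⟨ +-monoˡ-≤ _ (weighted-∸-≤ x b) ⟩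
  x * (suc x ∸ b) + suc x * (x ∸ a)     ≡⟨ +-comm _ (suc x * (x ∸ a)) ⟩
  suc x * (x ∸ a) + x * (suc x ∸ b)     ∎
  where open ≤-Reasoning

exchange-< : ∀ {x a b} → Extreme x a → 0 < b → b ≤ x →
  suc x * (x ∸ b) + x * (suc x ∸ a) < suc x * (x ∸ a) + x * (suc x ∸ b)
exchange-< {x} {a} {b} ext 0<b b≤x = begin-strict
  suc x * (x ∸ b) + x * (suc x ∸ a)     ≡⟨ cong (suc x * (x ∸ b) +_) (sym (extreme-balanced ext)) ⟩
  suc x * (x ∸ b) + suc x * (x ∸ a)     <⟨ +-monoˡ-< _ (weighted-∸-< 0<b b≤x) ⟩
  x * (suc x ∸ b) + suc x * (x ∸ a)     ≡⟨ +-comm _ (suc x * (x ∸ a)) ⟩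
  suc x * (x ∸ a) + x * (suc x ∸ b)     ∎
  where open ≤-Reasoning

∑-linear : ∀ {n} c d (f g : Fin n → ℕ) →
  ∑[ i < n ] (c * f i + d * g i) ≡ c * ∑[ i < n ] f i + d * ∑[ i < n ] g i
∑-linear c d f g = trans (∑-distrib-+ (λ i → c * f i) (λ i → d * g i))
  (sym (cong₂ _+_ (*-distribˡ-sum c f) (*-distribˡ-sum d g)))

shortfall : ∀ {n} → ℕ → (Fin n → ℕ) → ℕ
shortfall {n} x v = ∑[ i < n ] (x ∸ v i)

-- Multiply the claim by x + 1 and add x times the hypothesis: job by job, the combination
-- (x + 1) · (x ∸ ·) + x · (x + 1 ∸ ·) favours a (exchange-≤), and strictly so at o.
shortfall-<-of-extreme : ∀ {n} x (a b : Fin n → ℕ) o →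
  (∀ i → a i ≡ b i ⊎ Extreme x (a i)) → Extreme x (a o) → 0 < b o → b o ≤ x →
  shortfall (suc x) b ≤ shortfall (suc x) a → shortfall x b < shortfall x a
shortfall-<-of-extreme {n} x a b o agree ext 0<bo bo≤x ih =
  *-cancelˡ-< (suc x) _ _ (+-cancelʳ-< (x * shortfall (suc x) a) _ _ (begin-strict
    suc x * shortfall x b + x * shortfall (suc x) a
      ≡⟨ ∑-linear (suc x) x (λ i → x ∸ b i) (λ i → suc x ∸ a i) ⟨
    ∑[ i < n ] (suc x * (x ∸ b i) + x * (suc x ∸ a i))
      <⟨ ∑-mono-< (λ i → exchange-≤ x (a i) (b i) (agree i)) o (exchange-< ext 0<bo bo≤x) ⟩
    ∑[ i < n ] (suc x * (x ∸ a i) + x * (suc x ∸ b i))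
      ≡⟨ ∑-linear (suc x) x (λ i → x ∸ a i) (λ i → suc x ∸ b i) ⟩
    suc x * shortfall x a + x * shortfall (suc x) b
      ≤⟨ +-monoʳ-≤ _ (*-monoʳ-≤ x ih) ⟩
    suc x * shortfall x a + x * shortfall (suc x) a ∎))
  where open ≤-Reasoning

hit-just-self : ∀ {n} (i : Fin n) → hit (just i) i ≡ 1
hit-just-self i with i ≟ᶠ i
... | yes _   = refl
... | no  i≢i = contradiction refl i≢i

hit-just-other : ∀ {n} {i j : Fin n} → j ≢ i → hit (just j) i ≡ 0
hit-just-other {i = i} {j} j≢i with j ≟ᶠ i
... | yes j≡i = contradiction j≡i j≢i
... | no  _   = refl

hit≡0⊎just : ∀ {n} (m : Maybe (Fin n)) i → hit m i ≡ 0 ⊎ m ≡ just i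
hit≡0⊎just nothing  i = inj₁ refl
hit≡0⊎just (just j) i with j ≟ᶠ i
... | yes refl = inj₂ refl
... | no  _    = inj₁ refl

module _ {n} (σ : ℕ → Maybe (Fin n)) (i : Fin n) where

  served-mono-≤ : ∀ {s t} → s ≤ t → served σ i s ≤ served σ i t
  served-mono-≤ {t = zero}  z≤n = ≤-refl
  served-mono-≤ {t = suc t} s≤1+t with m≤n⇒m<n∨m≡n s≤1+t
  ... | inj₁ s<1+t = ≤-trans (served-mono-≤ (≤-pred s<1+t)) (m≤m+n _ _)
  ... | inj₂ refl  = ≤-refl

  served-suc-running : ∀ {t} → σ t ≡ just i → served σ i (suc t) ≡ suc (served σ i t)
  served-suc-running {t} σt≡i = begin
    served σ i t + hit (σ t) i    ≡⟨ cong (λ m → served σ i t + hit m i) σt≡i ⟩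
    served σ i t + hit (just i) i ≡⟨ cong (served σ i t +_) (hit-just-self i) ⟩
    served σ i t + 1              ≡⟨ +-comm _ 1 ⟩
    suc (served σ i t)            ∎
    where open ≡-Reasoning

  served-lastEnd : ∀ t → served σ i (lastEnd σ i t) ≡ served σ i t
  served-lastEnd zero = refl
  served-lastEnd (suc t) with hit (σ t) i in hit≡
  ... | zero  = trans (served-lastEnd t) (sym (+-identityʳ _))
  ... | suc _ = cong (served σ i t +_) hit≡

  lastEnd≤ : ∀ t → lastEnd σ i t ≤ t
  lastEnd≤ zero = z≤n
  lastEnd≤ (suc t) with hit (σ t) i
  ... | zero  = m≤n⇒m≤1+n (lastEnd≤ t)
  ... | suc _ = ≤-refl

  lastEnd-running : ∀ t {u} → lastEnd σ i t ≡ suc u → σ u ≡ just i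
  lastEnd-running (suc t) eq with hit (σ t) i in hit≡
  ... | zero  = lastEnd-running t eq
  ... | suc _ with refl ← eq with hit≡0⊎just (σ t) i
  ...   | inj₁ hit≡0   = contradiction (trans (sym hit≡) hit≡0) λ ()
  ...   | inj₂ σt≡i    = σt≡i

decrement : ∀ {n} → Maybe (Fin n) → (Fin n → ℕ) → Fin n → ℕ
decrement m v i = v i ∸ hit m i

shortfall-decrement-≥ : ∀ {n} x m (v : Fin n → ℕ) → shortfall x v ≤ shortfall x (decrement m v)
shortfall-decrement-≥ x m v = ∑-mono-≤ (λ i → ∸-monoʳ-≤ x (m∸n≤m (v i) (hit m i)))

shortfall-decrement-just : ∀ {n} x (v : Fin n → ℕ) j →
  shortfall x (decrement (just j) v) + (x ∸ v j) ≡ shortfall x v + (x ∸ (v j ∸ 1))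
shortfall-decrement-just {suc n} x v j = begin
  shortfall x v′ + f j                         ≡⟨ cong (_+ f j) (sum-remove {i = j} f′) ⟩
  (f′ j + sum (removeAt f′ j)) + f j           ≡⟨ cong₂ (λ a b → (a + b) + f j) f′j rest ⟩
  ((x ∸ (v j ∸ 1)) + sum (removeAt f j)) + f j ≡⟨ swap (x ∸ (v j ∸ 1)) _ _ ⟩
  (f j + sum (removeAt f j)) + (x ∸ (v j ∸ 1)) ≡⟨ cong (_+ (x ∸ (v j ∸ 1))) (sum-remove {i = j} f) ⟨
  shortfall x v + (x ∸ (v j ∸ 1))              ∎
  where
  open ≡-Reasoning
  v′ = decrement (just j) v
  f f′ : Fin (suc n) → ℕ
  f  i = x ∸ v i
  f′ i = x ∸ v′ i
  f′j : f′ j ≡ x ∸ (v j ∸ 1)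
  f′j = cong (λ h → x ∸ (v j ∸ h)) (hit-just-self j)
  rest : sum (removeAt f′ j) ≡ sum (removeAt f j)
  rest = sum-cong-≗ λ k → cong (λ h → x ∸ (v (punchIn j k) ∸ h)) (hit-just-other (punchInᵢ≢i j k ∘ sym))
  swap : ∀ a b c → (a + b) + c ≡ (c + b) + a
  swap = solve-∀

shortfall-decrement-≤ : ∀ {n} x m (v : Fin n → ℕ) → shortfall x (decrement m v) ≤ suc (shortfall x v)
shortfall-decrement-≤ x nothing  v = n≤1+n _
shortfall-decrement-≤ x (just j) v = +-cancelʳ-≤ (x ∸ v j) _ _ (begin
  shortfall x (decrement (just j) v) + (x ∸ v j) ≡⟨ shortfall-decrement-just x v j ⟩
  shortfall x v + (x ∸ (v j ∸ 1))                ≤⟨ +-monoʳ-≤ _ (m∸[n∸1]≤1+m∸n x (v j)) ⟩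
  shortfall x v + suc (x ∸ v j)                  ≡⟨ +-suc _ _ ⟩
  suc (shortfall x v) + (x ∸ v j)                ∎)
  where open ≤-Reasoning

shortfall-decrement-above : ∀ {n} x (v : Fin n → ℕ) j → x < v j →
  shortfall x (decrement (just j) v) ≡ shortfall x v
shortfall-decrement-above x v j x<vj = +-cancelʳ-≡ (x ∸ v j) _ _ (begin
  shortfall x (decrement (just j) v) + (x ∸ v j) ≡⟨ shortfall-decrement-just x v j ⟩
  shortfall x v + (x ∸ (v j ∸ 1))                ≡⟨ cong (shortfall x v +_) (m<n⇒m∸[n∸1]≡m∸n x<vj) ⟩
  shortfall x v + (x ∸ v j)                      ∎)
  where open ≡-Reasoning

shortfall-decrement-within : ∀ {n} x (v : Fin n → ℕ) j → 0 < v j → v j ≤ x →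
  shortfall x (decrement (just j) v) ≡ suc (shortfall x v)
shortfall-decrement-within x v j 0<vj vj≤x = +-cancelʳ-≡ (x ∸ v j) _ _ (begin
  shortfall x (decrement (just j) v) + (x ∸ v j) ≡⟨ shortfall-decrement-just x v j ⟩
  shortfall x v + (x ∸ (v j ∸ 1))                ≡⟨ cong (shortfall x v +_) pred-gain ⟩
  shortfall x v + suc (x ∸ v j)                  ≡⟨ +-suc _ _ ⟩
  suc (shortfall x v) + (x ∸ v j)                ∎)
  where
  open ≡-Reasoning
  pred-gain : x ∸ (v j ∸ 1) ≡ suc (x ∸ v j)
  pred-gain = 0<n≤m⇒m∸[n∸1]≡1+m∸n 0<vj vj≤x

remainingAt : ∀ {n} (p : Fin n → ℕ) → Schedule n → ℕ → Fin n → ℕ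
remainingAt p X t i = remaining p X i t

remainingAt-suc : ∀ {n} (p : Fin n → ℕ) X t →
  remainingAt p X (suc t) ≗ decrement (slot X t) (remainingAt p X t)
remainingAt-suc p X t i = sym (∸-+-assoc (p i) (served (slot X) i t) (hit (slot X t) i))

shortfall-next : ∀ {n} (p : Fin n → ℕ) X x t →
  shortfall x (remainingAt p X (suc t)) ≡ shortfall x (decrement (slot X t) (remainingAt p X t))
shortfall-next p X x t = sum-cong-≗ λ i → cong (x ∸_) (remainingAt-suc p X t i)

active? : ∀ {n} (r p : Fin n → ℕ) (X : Schedule n) t i → Dec (Active r p X t i)
active? r p X t i = r i ≤? t ×-dec served (slot X) i t <? p i

pending : ∀ {n} (r p : Fin n → ℕ) → Schedule n → ℕ → ℕ
pending {n} r p X t = ∑[ i < n ] 𝟙 (active? r p X t i)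

module FeasibleSchedule {n} {r p : Fin n → ℕ} {X : Schedule n} (feasible : Feasible r p X) where

  private
    σ = slot X
    idle-after-horizon = proj₁ feasible
    served-horizon     = proj₁ (proj₂ feasible)
    runs-after-release = proj₂ (proj₂ feasible)

  served-before-release : ∀ i {t} → t ≤ r i → served σ i t ≡ 0
  served-before-release i {zero}  _   = refl
  served-before-release i {suc t} t<r with hit≡0⊎just (σ t) i
  ... | inj₁ hit≡0 = cong₂ _+_ (served-before-release i (≤-trans (n≤1+n t) t<r)) hit≡0
  ... | inj₂ σt≡i  = contradiction (runs-after-release t i σt≡i) (<⇒≱ t<r)

  running⇒active : ∀ t i → σ t ≡ just i → Active r p X t i
  running⇒active t i σt≡i = runs-after-release t i σt≡i , (begin-strict
    served σ i t           <⟨ n<1+n _ ⟩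
    suc (served σ i t)     ≡⟨ served-suc-running σ i σt≡i ⟨
    served σ i (suc t)     ≤⟨ served-mono-≤ σ i t<horizon ⟩
    served σ i (horizon X) ≡⟨ served-horizon i ⟩
    p i                    ∎)
    where
    open ≤-Reasoning
    t<horizon : t < horizon X
    t<horizon = ≰⇒> λ horizon≤t → contradiction (trans (sym σt≡i) (idle-after-horizon t horizon≤t)) λ ()

  served-completion : ∀ i → served σ i (completion X i) ≡ p i
  served-completion i = trans (served-lastEnd σ i (horizon X)) (served-horizon i)

  served-<-before-completion : ∀ i {t} → t < completion X i → served σ i t < p i
  served-<-before-completion i {t} t<c with completion X i in c≡ | t<c
  ... | suc u | s≤s t≤u = begin-strict
    served σ i t                ≤⟨ served-mono-≤ σ i t≤u ⟩
    served σ i u                <⟨ n<1+n _ ⟩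
    suc (served σ i u)          ≡⟨ served-suc-running σ i (lastEnd-running σ i (horizon X) c≡) ⟨
    served σ i (suc u)          ≡⟨ cong (served σ i) c≡ ⟨
    served σ i (completion X i) ≡⟨ served-completion i ⟩
    p i                         ∎
    where open ≤-Reasoning

  active⇔within-flow : ∀ i t → Active r p X t i ⇔ (r i ≤ t × t < completion X i)
  active⇔within-flow i t = mk⇔
    (λ (r≤t , served<p) → r≤t , ≰⇒> λ c≤t →
      <⇒≱ served<p (subst (_≤ served σ i t) (served-completion i) (served-mono-≤ σ i c≤t)))
    (λ (r≤t , t<c) → r≤t , served-<-before-completion i t<c)

  flow≡pending-time : ∀ i {M} → horizon X ≤ M → flow r X i ≡ sumBelow M (λ t → 𝟙 (active? r p X t i))
  flow≡pending-time i {M} horizon≤M = sym (begin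
    sumBelow M (λ t → 𝟙 (active? r p X t i))
      ≡⟨ sumBelow-cong M (λ t → 𝟙-cong (active⇔within-flow i t) _ _) ⟩
    sumBelow M (λ t → 𝟙 (r i ≤? t ×-dec t <? completion X i))
      ≡⟨ sumBelow-interval (r i) (completion X i) M ⟩
    (M ⊓ completion X i) ∸ r i
      ≡⟨ cong (_∸ r i) (m≥n⇒m⊓n≡n c≤M) ⟩
    flow r X i ∎)
    where
    open ≡-Reasoning
    c≤M : completion X i ≤ M
    c≤M = ≤-trans (lastEnd≤ σ i (horizon X)) horizon≤M

  total-flow≡∑-pending : ∀ {M} → horizon X ≤ M → ∑[ i < n ] flow r X i ≡ sumBelow M (pending r p X)
  total-flow≡∑-pending {M} horizon≤M =
    trans (sum-cong-≗ (λ i → flow≡pending-time i horizon≤M))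
          (∑-sumBelow-comm M (λ i t → 𝟙 (active? r p X t i)))

  pending+finished≡released : (∀ i → 1 ≤ p i) → ∀ t →
    pending r p X t + shortfall 1 (remainingAt p X t) ≡ ∑[ i < n ] 𝟙 (r i ≤? t)
  pending+finished≡released 1≤p t =
    trans (sym (∑-distrib-+ (λ i → 𝟙 (active? r p X t i)) _)) (sum-cong-≗ per-job)
    where
    per-job : ∀ i → 𝟙 (active? r p X t i) + (1 ∸ remaining p X i t) ≡ 𝟙 (r i ≤? t)
    per-job i with r i ≤? t | served σ i t <? p i
    ... | yes _   | yes served<p = cong suc (m≤n⇒m∸n≡0 (m<n⇒0<n∸m served<p))
    ... | yes _   | no  served≮p = cong (1 ∸_) (m≤n⇒m∸n≡0 (≮⇒≥ served≮p))
    ... | no  r≰t | _            =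
      trans (cong (λ s → 1 ∸ (p i ∸ s)) (served-before-release i (<⇒≤ (≰⇒> r≰t)))) (m≤n⇒m∸n≡0 (1≤p i))

released⇒active⊎finished : ∀ {n} {r p : Fin n → ℕ} X {t} i → r i ≤ t →
  Active r p X t i ⊎ remaining p X i t ≡ 0
released⇒active⊎finished {p = p} X {t} i r≤t with served (slot X) i t <? p i
... | yes served<p = inj₁ (r≤t , served<p)
... | no  served≮p = inj₂ (m≤n⇒m∸n≡0 (≮⇒≥ served≮p))

srpt-runs-short⊎released-extreme : ∀ {n} {r p : Fin n → ℕ} {S} → IsSRPT r p S → ∀ t x →
    (∃ λ s → slot S t ≡ just s × 0 < remaining p S s t × remaining p S s t ≤ x)
  ⊎ (∀ i → r i ≤ t → Extreme x (remaining p S i t))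
srpt-runs-short⊎released-extreme {r = r} {p} {S} srpt t x with any? (active? r p S t)
... | no none = inj₂ λ i r≤t →
  [ (λ active → contradiction (i , active) none) , inj₁ ]′
    (released⇒active⊎finished {r = r} {p} S i r≤t)
... | yes some with srpt t some
... | s , σt≡s , (_ , served<p) , shortest with remaining p S s t ≤? x
...   | yes rem≤x = inj₁ (s , σt≡s , m<n⇒0<n∸m served<p , rem≤x)
...   | no  rem≰x = inj₂ λ i r≤t →
  [ (λ active → inj₂ (<-≤-trans (≰⇒> rem≰x) (shortest i active))) , inj₁ ]′
    (released⇒active⊎finished {r = r} {p} S i r≤t)

module SRPTDominance {n} {r p : Fin n → ℕ} {S O : Schedule n}
  (S-feasible : Feasible r p S) (srpt : IsSRPT r p S) (O-feasible : Feasible r p O) where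

  private
    module S = FeasibleSchedule S-feasible
    module O = FeasibleSchedule O-feasible

  unreleased-agree : ∀ t i → ¬ r i ≤ t → remaining p S i t ≡ remaining p O i t
  unreleased-agree t i r≰t =
    cong (p i ∸_) (trans (S.served-before-release i t≤r) (sym (O.served-before-release i t≤r)))
    where t≤r = <⇒≤ (≰⇒> r≰t)

  dominance-step : ∀ t x →
    (∀ y → shortfall y (remainingAt p O t) ≤ shortfall y (remainingAt p S t)) →
    shortfall x (remainingAt p O (suc t)) ≤ shortfall x (remainingAt p S (suc t))
  dominance-step t x ih = subst₂ _≤_ (sym (shortfall-next p O x t)) (sym (shortfall-next p S x t)) step
    where
    a b : Fin n → ℕ
    a = remainingAt p S t
    b = remainingAt p O t
    S-step-≥ : shortfall x a ≤ shortfall x (decrement (slot S t) a)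
    S-step-≥ = shortfall-decrement-≥ x (slot S t) a
    catch-up : ∀ o → r o ≤ t → 0 < b o → b o ≤ x →
               suc (shortfall x b) ≤ shortfall x (decrement (slot S t) a)
    catch-up o r≤t 0<bo bo≤x with srpt-runs-short⊎released-extreme {r = r} {p} {S} srpt t x
    ... | inj₁ (s , σt≡s , 0<as , as≤x) = begin
      suc (shortfall x b)                  ≤⟨ s≤s (ih x) ⟩
      suc (shortfall x a)                  ≡⟨ shortfall-decrement-within x a s 0<as as≤x ⟨
      shortfall x (decrement (just s) a)   ≡⟨ cong (λ m → shortfall x (decrement m a)) σt≡s ⟨
      shortfall x (decrement (slot S t) a) ∎
      where open ≤-Reasoning
    ... | inj₂ extreme =
      ≤-trans (shortfall-<-of-extreme x a b o agree (extreme o r≤t) 0<bo bo≤x (ih (suc x))) S-step-≥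
      where
      agree : ∀ i → a i ≡ b i ⊎ Extreme x (a i)
      agree i with r i ≤? t
      ... | yes r≤t′ = inj₂ (extreme i r≤t′)
      ... | no  r≰t  = inj₁ (unreleased-agree t i r≰t)
    step : shortfall x (decrement (slot O t) b) ≤ shortfall x (decrement (slot S t) a)
    step with slot O t in σt≡
    ... | nothing = ≤-trans (ih x) S-step-≥
    ... | just o with O.running⇒active t o σt≡ | x <? b o
    ...   | _ , _          | yes x<bo = begin
      shortfall x (decrement (just o) b)   ≡⟨ shortfall-decrement-above x b o x<bo ⟩
      shortfall x b                        ≤⟨ ih x ⟩
      shortfall x a                        ≤⟨ S-step-≥ ⟩
      shortfall x (decrement (slot S t) a) ∎
      where open ≤-Reasoning
    ...   | r≤t , served<p | no  x≮bo =
      ≤-trans (shortfall-decrement-≤ x (just o) b) (catch-up o r≤t (m<n⇒0<n∸m served<p) (≮⇒≥ x≮bo))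

  shortfall-dominance : ∀ t x → shortfall x (remainingAt p O t) ≤ shortfall x (remainingAt p S t)
  shortfall-dominance zero    x = ≤-refl
  shortfall-dominance (suc t) x = dominance-step t x (shortfall-dominance t)

  srpt-pending-≤ : (∀ i → 1 ≤ p i) → ∀ t → pending r p S t ≤ pending r p O t
  srpt-pending-≤ 1≤p t = +-cancelʳ-≤ (shortfall 1 (remainingAt p O t)) _ _ (begin
    pending r p S t + shortfall 1 (remainingAt p O t) ≤⟨ +-monoʳ-≤ _ (shortfall-dominance t 1) ⟩
    pending r p S t + shortfall 1 (remainingAt p S t) ≡⟨ S.pending+finished≡released 1≤p t ⟩
    ∑[ i < n ] 𝟙 (r i ≤? t)                           ≡⟨ O.pending+finished≡released 1≤p t ⟨
    pending r p O t + shortfall 1 (remainingAt p O t) ∎)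
    where open ≤-Reasoning

  srpt-total-flow-≤ : (∀ i → 1 ≤ p i) → ∑[ i < n ] flow r S i ≤ ∑[ i < n ] flow r O i
  srpt-total-flow-≤ 1≤p = begin
    ∑[ i < n ] flow r S i      ≡⟨ S.total-flow≡∑-pending (m≤m+n (horizon S) (horizon O)) ⟩
    sumBelow M (pending r p S) ≤⟨ sumBelow-mono-≤ M (srpt-pending-≤ 1≤p) ⟩
    sumBelow M (pending r p O) ≡⟨ O.total-flow≡∑-pending (m≤n+m (horizon O) (horizon S)) ⟨
    ∑[ i < n ] flow r O i      ∎
    where
    open ≤-Reasoning
    M = horizon S + horizon O

corollaryC2 : (n : ℕ) (r p : Fin n → ℕ) → (∀ i → 1 ≤ p i)
    → (S : Schedule n) → Feasible r p S → IsSRPT r p S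
    → (O : Schedule n) → Feasible r p O
    → F r S ≤ n * F r O
corollaryC2 n r p 1≤p S S-feasible srpt O O-feasible = begin
  F r S                                          ≡⟨ sum-allFin n (λ i → fS i * fS i) ⟩
  ∑[ i < n ] (fS i * fS i)                       ≤⟨ ∑-squares≤square-∑ n fS ⟩
  (∑[ i < n ] fS i) * (∑[ i < n ] fS i)          ≤⟨ *-mono-≤ total-flow-≤ total-flow-≤ ⟩
  (∑[ i < n ] fO i) * (∑[ i < n ] fO i)          ≤⟨ ∑-cauchy-schwarz n fO ⟩
  n * ∑[ i < n ] (fO i * fO i)                   ≡⟨ cong (n *_) (sum-allFin n (λ i → fO i * fO i)) ⟨
  n * F r O                                      ∎
  where
  open ≤-Reasoning
  fS fO : Fin n → ℕ
  fS = flow r S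
  fO = flow r O
  total-flow-≤ : ∑[ i < n ] fS i ≤ ∑[ i < n ] fO i
  total-flow-≤ = SRPTDominance.srpt-total-flow-≤ S-feasible srpt O-feasible 1≤p
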